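{- Fix integers $k\ge 2$ and $J\ge 0$, and let $h^{(j)}_{i,l}(q)$ be the polynomials defined in the context. Let $j\ge J+1$ and $i,l\in\{1,\dots,k\}$, and write $h^{(j)}_{i,l}=\sum_{n\ge0}h^{(j)}_{i,l}(n)q^n$. If $k$ is odd and $l\not\equiv i\pmod 2$, then $h^{(j)}_{i,l}=0$; if $k$ is even and $j-J+l\not\equiv i\pmod 2$, then $h^{(j)}_{i,l}=0$. Otherwise, for every $n\ge 0$, $h^{(j)}_{i,l}(n)$ equals the number of partitions $\pi=(\pi_1,\dots,\pi_{\ell(\pi)})$ of $n$ such that: (1) $\pi_t-\pi_{t+k-1}\ge 2$ for all positive integers $t$ with $t+k-1\le\ell(\pi)$; (2) $\pi_1\le j$; (3) $m_j(\pi)\in\{l-2,l-1\}\cap\mathbb{N}$; (4) $\pi_{\ell(\pi)}>J$; (5) $m_{J+1}(\pi)\le k-i$; (6) for all positive integers $t$ with $t+k-2\le\ell(\pi)$, $\pi_t-\pi_{t+k-2}\le 1$ only if $\pi_t+\pi_{t+1}+\cdots+\pi_{t+k-2}\equiv (k-1)j+l-k\pmod 2$.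
   Context: $q$ is a formal variable. For fixed $k\ge 2$, $J\ge 0$ and $i\in\{1,\dots,k\}$, define polynomials $h^{(j)}_{i,l}(q)$ for $j\ge J$, $l\in\{1,\dots,k\}$ by $h^{(J)}_{i,l}=1$ if $l=i$ and $0$ otherwise, and for $j\ge J$: \[ h^{(j+1)}_{i,1}=\sum_{\substack{1\le t\le k\\ t\equiv k \ (\mathrm{mod}\ 2)}}h^{(j)}_{i,t},\qquad h^{(j+1)}_{i,l}=(1+q^{j+1})\,q^{(l-2)(j+1)}\sum_{\substack{1\le t\le k-l+1\\ t\equiv l+k+1\ (\mathrm{mod}\ 2)}}h^{(j)}_{i,t}\quad (2\le l\le k). \] A partition of $n$ is a nonincreasing finite sequence $\pi_1\ge\pi_2\ge\cdots\ge\pi_{\ell(\pi)}$ of positive integers summing to $n$ (the empty partition is the unique partition of $0$); $\ell(\pi)$ is its number of parts and $m_p(\pi)$ is the number of parts equal to $p$. $\mathbb{N}$ denotes the nonnegative integers. -}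

module Defs where

open import Data.Nat using (ℕ; zero; suc; _+_; _*_; _∸_; _≤_; _<_; _≤?_; _%_)
open import Data.Nat.Properties using (_≟_)
open import Data.Bool using (Bool; true; false; if_then_else_)
open import Data.List using (List; []; _∷_; length)
open import Data.List.Membership.Propositional using (_∈_)
open import Data.List.Relation.Unary.Unique.Propositional using (Unique)
open import Data.List.Relation.Unary.All using (All)
open import Data.Product using (Σ; _×_)
open import Data.Sum using (_⊎_)
open import Function.Bundles using (_⇔_)
open import Relation.Nullary.Decidable using (⌊_⌋)
open import Relation.Binary.PropositionalEquality using (_≡_)

-- Polynomials in q with ℕ coefficients are represented by their
-- coefficient sequences ℕ → ℕ (value at n = coefficient of q^n).

sumFrom1 : ℕ → (ℕ → ℕ) → ℕ
sumFrom1 zero    f = 0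
sumFrom1 (suc m) f = sumFrom1 m f + f (suc m)

shiftCoeff : ℕ → (ℕ → ℕ) → ℕ → ℕ
shiftCoeff s p n = if ⌊ s ≤? n ⌋ then p (n ∸ s) else 0

-- Hc k J i d l n = coefficient of q^n in h^{(J+d)}_{i,l}(q)
Hc : (k J i d : ℕ) → ℕ → ℕ → ℕ
Hc k J i zero    l n = if ⌊ l ≟ i ⌋ then (if ⌊ n ≟ 0 ⌋ then 1 else 0) else 0
Hc k J i (suc d) zero n = 0
Hc k J i (suc d) (suc zero) n =
  sumFrom1 k (λ t → if ⌊ t % 2 ≟ k % 2 ⌋ then Hc k J i d t n else 0)
Hc k J i (suc d) (suc (suc l′)) n =
  sumFrom1 (k ∸ l + 1)
    (λ t → if ⌊ t % 2 ≟ (l + k + 1) % 2 ⌋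
             then shiftCoeff e (Hc k J i d t) n
                  + shiftCoeff (e + jj) (Hc k J i d t) n
             else 0)
  where
    l  = suc (suc l′)
    jj = J + suc d          -- the new index j+1
    e  = l′ * jj

-- h k J i j l n = coefficient of q^n in h^{(j)}_{i,l}(q), for j ≥ J
h : (k J i j l n : ℕ) → ℕ
h k J i j l n = Hc k J i (j ∸ J) l n

data Nonincreasing : List ℕ → Set where
  ni-[]  : Nonincreasing []
  ni-[x] : ∀ {x} → Nonincreasing (x ∷ [])
  ni-∷   : ∀ {x y ys} → y ≤ x → Nonincreasing (y ∷ ys) → Nonincreasing (x ∷ y ∷ ys)

sumL : List ℕ → ℕ
sumL []       = 0
sumL (x ∷ xs) = x + sumL xs

IsPartition : ℕ → List ℕ → Set
IsPartition n π = Nonincreasing π × All (λ p → 0 < p) π × sumL π ≡ n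

-- part π t = π_t (1-indexed); 0 when t is out of range
part : List ℕ → ℕ → ℕ
part []       _             = 0
part (x ∷ xs) zero          = 0
part (x ∷ xs) (suc zero)    = x
part (x ∷ xs) (suc (suc t)) = part xs (suc t)

mult : ℕ → List ℕ → ℕ
mult p []       = 0
mult p (x ∷ xs) = (if ⌊ x ≟ p ⌋ then 1 else 0) + mult p xs

windowSum : List ℕ → ℕ → ℕ → ℕ
windowSum π t zero    = part π t
windowSum π t (suc r) = windowSum π t r + part π (t + suc r)

Conditions : (k J i j l : ℕ) → List ℕ → Set
Conditions k J i j l π =
  (∀ t → 1 ≤ t → t + k ∸ 1 ≤ length π → 2 + part π (t + k ∸ 1) ≤ part π t)
  × (∀ r → length π ≡ suc r → part π 1 ≤ j)
  × (mult j π + 2 ≡ l ⊎ mult j π + 1 ≡ l)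
  × (∀ r → length π ≡ suc r → J < part π (suc r))
  × (mult (J + 1) π ≤ k ∸ i)
  -- (6)  parity of window sum ≡ (k-1)j + l - k (mod 2), i.e. sum + k ≡ (k-1)j + l
  × (∀ t → 1 ≤ t → t + k ∸ 2 ≤ length π →
       part π t ≤ 1 + part π (t + k ∸ 2) →
       (windowSum π t (k ∸ 2) + k) % 2 ≡ ((k ∸ 1) * j + l) % 2)

HasCount : (List ℕ → Set) → ℕ → Set
HasCount P c =
  Σ (List (List ℕ)) λ L → Unique L × (∀ π → (π ∈ L) ⇔ P π) × length L ≡ c

-- Induction on j along the recurrence defining h. In a partition counted at level j + 1 with index l,
-- the m = m_{j+1}(π) ∈ {l - 2, l - 1} largest parts equal j + 1; removing them leaves a partition
-- counted at level j with the index t ∈ {m_j + 1, m_j + 2} of parity l + k + 1, which is exactly the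
-- parity that turns the target (k - 1)(j + 1) + l of condition (6) into (k - 1) j + t. Condition (1)
-- says m + m_j ≤ k - 1, and condition (6) on the window of the k - 1 largest parts excludes m = l - 2
-- with m + m_j = k - 1; together these give exactly the range t ≤ k - l + 1 of the recurrence, whose
-- factor (1 + q^{j+1}) q^{(l-2)(j+1)} accounts for the m copies of j + 1. At j = J + 1 nothing remains
-- and condition (5) bounds m instead. Along the recurrence the parity of l + (j - J)(k + 1) stays that
-- of i, which gives the vanishing statements.

module Submission where

open import Defs
open import Data.Nat using (ℕ; zero; suc; _+_; _*_; _∸_; _≤_; _<_; _≤?_; _%_; s≤s; z≤n; z<s; parity)
open import Data.Nat.Properties
open import Data.Nat.DivMod using ([m+n]%n≡m%n)
open import Data.Nat.Tactic.RingSolver using (solve-∀)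
open import Data.Parity.Base using (Parity; 0ℙ; 1ℙ; _⁻¹) renaming (_+_ to _+ℙ_; _*_ to _*ℙ_)
import Data.Parity.Properties as ℙ
open import Data.Bool using (if_then_else_)
open import Data.List using (List; []; _∷_; length; _++_; map; replicate; take)
open import Data.List.Properties using (length-++; length-map; length-replicate; ++-cancelˡ; ++-assoc)
open import Data.List.Membership.Propositional using (_∈_)
open import Data.List.Membership.Propositional.Properties using (∈-++⁺ˡ; ∈-++⁺ʳ; ∈-++⁻; ∈-map⁺; ∈-map⁻)
import Data.List.Relation.Unary.Unique.Propositional.Properties as Unique
open import Data.List.Relation.Unary.AllPairs using ([]; _∷_)
open import Data.List.Relation.Unary.Any using (here)
open import Data.List.Relation.Unary.All as All using (All; []; _∷_)
open import Data.List.Relation.Unary.All.Properties using (++⁺; ++⁻ʳ; replicate⁺)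
open import Data.Product using (∃; _×_; _,_; proj₁; proj₂)
open import Data.Sum as Sum using (_⊎_; inj₁; inj₂; [_,_])
open import Data.Empty using (⊥-elim)
open import Function.Bundles using (_⇔_; mk⇔; Equivalence)
import Function.Properties.Equivalence as ⇔
open import Function using (_∘_)
open import Relation.Binary.Bundles using (Setoid)
import Relation.Binary.Reasoning.Setoid as ≈-Reasoning
open import Relation.Nullary using (¬_; Dec; yes; no; contradiction)
open import Relation.Nullary.Decidable using (⌊_⌋)
import Relation.Nullary.Decidable as Dec
open import Relation.Binary.PropositionalEquality
  using (_≡_; _≢_; refl; sym; trans; cong; cong₂; subst; module ≡-Reasoning)

open Equivalence

-- Counting

HasCount-cong : ∀ {P Q : List ℕ → Set} {a b} → (∀ π → P π ⇔ Q π) → a ≡ b → HasCount P a → HasCount Q b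
HasCount-cong P⇔Q refl (L , unique , ∈L⇔P , length≡) =
  L , unique , (λ π → ⇔.trans (∈L⇔P π) (P⇔Q π)) , length≡

HasCount-none : ∀ {P : List ℕ → Set} → (∀ π → ¬ P π) → HasCount P 0
HasCount-none ¬P = [] , [] , (λ π → mk⇔ (λ ()) (λ p → ⊥-elim (¬P π p))) , refl

HasCount-⊎ : ∀ {P Q : List ℕ → Set} {a b} → HasCount P a → HasCount Q b →
             (∀ π → P π → ¬ Q π) → HasCount (λ π → P π ⊎ Q π) (a + b)
HasCount-⊎ {P} {Q} (L₁ , u₁ , ∈L₁⇔P , l₁) (L₂ , u₂ , ∈L₂⇔Q , l₂) disjoint =
  L₁ ++ L₂ ,
  Unique.++⁺ u₁ u₂ (λ (x₁ , x₂) → disjoint _ (to (∈L₁⇔P _) x₁) (to (∈L₂⇔Q _) x₂)) ,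
  (λ π → mk⇔ (λ x → Sum.map (to (∈L₁⇔P π)) (to (∈L₂⇔Q π)) (∈-++⁻ L₁ x)) ∈-++) ,
  trans (length-++ L₁) (cong₂ _+_ l₁ l₂)
  where
    ∈-++ : ∀ {π} → P π ⊎ Q π → π ∈ L₁ ++ L₂
    ∈-++ (inj₁ x) = ∈-++⁺ˡ (from (∈L₁⇔P _) x)
    ∈-++ (inj₂ x) = ∈-++⁺ʳ L₁ (from (∈L₂⇔Q _) x)

HasCount-image : ∀ {P : List ℕ → Set} {a} (f : List ℕ → List ℕ) → (∀ {x y} → f x ≡ f y → x ≡ y) →
                 HasCount P a → HasCount (λ π → ∃ λ π′ → P π′ × π ≡ f π′) a
HasCount-image f f-injective (L , unique , ∈L⇔P , length≡) =
  map f L , Unique.map⁺ f-injective unique ,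
  (λ π → mk⇔ (λ x → let (π′ , π′∈L , π≡fπ′) = ∈-map⁻ f x in π′ , to (∈L⇔P π′) π′∈L , π≡fπ′)
              (λ { (π′ , p , refl) → ∈-map⁺ f (from (∈L⇔P π′) p) })) ,
  trans (length-map f L) length≡

HasCount-⋃ : ∀ (A : ℕ → List ℕ → Set) (c : ℕ → ℕ) K →
             (∀ t → 1 ≤ t → t ≤ K → HasCount (A t) (c t)) →
             (∀ t₁ t₂ π → A t₁ π → A t₂ π → t₁ ≡ t₂) →
             HasCount (λ π → ∃ λ t → 1 ≤ t × t ≤ K × A t π) (sumFrom1 K c)
HasCount-⋃ A c zero count determined = HasCount-none λ { π (t , 1≤t , t≤0 , _) → <⇒≱ 1≤t t≤0 }
HasCount-⋃ A c (suc K) count determined =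
  HasCount-cong (λ π → mk⇔ join split) refl
    (HasCount-⊎ (HasCount-⋃ A c K (λ t 1≤t t≤K → count t 1≤t (m≤n⇒m≤1+n t≤K)) determined)
                (count (suc K) (s≤s z≤n) ≤-refl)
                (λ { π (t , _ , t≤K , x) y → 1+n≰n (subst (_≤ K) (determined t (suc K) π x y) t≤K) }))
  where
    join : ∀ {π} → (∃ λ t → 1 ≤ t × t ≤ K × A t π) ⊎ A (suc K) π → ∃ λ t → 1 ≤ t × t ≤ suc K × A t π
    join (inj₁ (t , 1≤t , t≤K , x)) = t , 1≤t , m≤n⇒m≤1+n t≤K , x
    join (inj₂ x) = suc K , s≤s z≤n , ≤-refl , x
    split : ∀ {π} → (∃ λ t → 1 ≤ t × t ≤ suc K × A t π) → (∃ λ t → 1 ≤ t × t ≤ K × A t π) ⊎ A (suc K) π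
    split (t , 1≤t , t≤1+K , x) with t ≟ suc K
    ... | yes refl = inj₂ x
    ... | no t≢1+K = inj₁ (t , 1≤t , ≤-pred (≤∧≢⇒< t≤1+K t≢1+K) , x)

HasCount-if : ∀ {B : List ℕ → Set} {g} x y → (x ≡ y → HasCount B g) →
              HasCount (λ π → x ≡ y × B π) (if ⌊ x ≟ y ⌋ then g else 0)
HasCount-if x y count with x ≟ y
... | yes x≡y = HasCount-cong (λ π → mk⇔ (x≡y ,_) proj₂) refl (count x≡y)
... | no x≢y = HasCount-none (λ π p → x≢y (proj₁ p))

Prepend : (ℕ → List ℕ → Set) → ℕ → ℕ → ℕ → List ℕ → Set
Prepend T p m n π = ∃ λ π′ → m * p ≤ n × T (n ∸ m * p) π′ × π ≡ replicate m p ++ π′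

HasCount-Prepend : ∀ {T : ℕ → List ℕ → Set} (H : ℕ → ℕ) p m n → (∀ n′ → HasCount (T n′) (H n′)) →
                   HasCount (Prepend T p m n) (shiftCoeff (m * p) H n)
HasCount-Prepend H p m n count with m * p ≤? n
... | yes mp≤n = HasCount-cong (λ π → mk⇔ (λ (π′ , t , e) → π′ , mp≤n , t , e) (λ (π′ , _ , t , e) → π′ , t , e))
                   refl (HasCount-image (replicate m p ++_) (++-cancelˡ (replicate m p) _ _) (count (n ∸ m * p)))
... | no mp≰n = HasCount-none (λ { π (_ , mp≤n , _) → mp≰n mp≤n })

if-zero : ∀ {x y} g → (x ≡ y → g ≡ 0) → (if ⌊ x ≟ y ⌋ then g else 0) ≡ 0
if-zero {x} {y} g g≡0 with x ≟ y
... | yes x≡y = g≡0 x≡y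
... | no _ = refl

sumFrom1-zero : ∀ m (f : ℕ → ℕ) → (∀ t → f t ≡ 0) → sumFrom1 m f ≡ 0
sumFrom1-zero zero f f≡0 = refl
sumFrom1-zero (suc m) f f≡0 = cong₂ _+_ (sumFrom1-zero m f f≡0) (f≡0 (suc m))

shiftCoeff-zero : ∀ s (H : ℕ → ℕ) n → (∀ n → H n ≡ 0) → shiftCoeff s H n ≡ 0
shiftCoeff-zero s H n H≡0 with s ≤? n
... | yes _ = H≡0 (n ∸ s)
... | no _ = refl

-- Parity

infix 4 _≡₂_

record _≡₂_ (m n : ℕ) : Set where
  constructor mk≡₂
  field parity≡ : parity m ≡ parity n

open _≡₂_

≡₂-setoid : Setoid _ _
≡₂-setoid = record
  { Carrier = ℕ
  ; _≈_ = _≡₂_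
  ; isEquivalence = record
    { refl = mk≡₂ refl
    ; sym = λ e → mk≡₂ (sym (parity≡ e))
    ; trans = λ e f → mk≡₂ (trans (parity≡ e) (parity≡ f))
    }
  }

open Setoid ≡₂-setoid using () renaming (refl to ≡₂-refl; sym to ≡₂-sym; trans to ≡₂-trans)

≡⇒≡₂ : ∀ {m n} → m ≡ n → m ≡₂ n
≡⇒≡₂ refl = ≡₂-refl

private
  toℕ : Parity → ℕ
  toℕ 0ℙ = 0
  toℕ 1ℙ = 1

  toℕ-injective : ∀ {p q} → toℕ p ≡ toℕ q → p ≡ q
  toℕ-injective {0ℙ} {0ℙ} _ = refl
  toℕ-injective {1ℙ} {1ℙ} _ = refl

  %2≡toℕ∘parity : ∀ n → n % 2 ≡ toℕ (parity n)
  %2≡toℕ∘parity 0 = refl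
  %2≡toℕ∘parity 1 = refl
  %2≡toℕ∘parity (suc (suc n)) =
    trans (cong (_% 2) (+-comm 2 n)) (trans ([m+n]%n≡m%n n 2) (%2≡toℕ∘parity n))

%2≡⇔≡₂ : ∀ m n → m % 2 ≡ n % 2 ⇔ m ≡₂ n
%2≡⇔≡₂ m n = mk⇔
  (λ e → mk≡₂ (toℕ-injective (trans (sym (%2≡toℕ∘parity m)) (trans e (%2≡toℕ∘parity n)))))
  (λ e → trans (%2≡toℕ∘parity m) (trans (cong toℕ (parity≡ e)) (sym (%2≡toℕ∘parity n))))

≡₂-+ : ∀ {a b c d} → a ≡₂ b → c ≡₂ d → a + c ≡₂ b + d
≡₂-+ {a} {b} {c} {d} (mk≡₂ a≡₂b) (mk≡₂ c≡₂d) =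
  mk≡₂ (trans (ℙ.+-homo-+ a c) (trans (cong₂ _+ℙ_ a≡₂b c≡₂d) (sym (ℙ.+-homo-+ b d))))

≡₂-*ˡ : ∀ a {b c} → b ≡₂ c → a * b ≡₂ a * c
≡₂-*ˡ a {b} {c} (mk≡₂ b≡₂c) =
  mk≡₂ (trans (ℙ.*-homo-* a b) (trans (cong (parity a *ℙ_) b≡₂c) (sym (ℙ.*-homo-* a c))))

≡₂-cancelˡ : ∀ a {b c} → a + b ≡₂ a + c → b ≡₂ c
≡₂-cancelˡ a {b} {c} (mk≡₂ e) =
  mk≡₂ (ℙ.+-cancelˡ-≡ (parity a) _ _ (trans (sym (ℙ.+-homo-+ a b)) (trans e (ℙ.+-homo-+ a c))))

n+n≡₂0 : ∀ n → n + n ≡₂ 0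
n+n≡₂0 n = mk≡₂ (trans (ℙ.+-homo-+ n n) (ℙ.p+p≡0ℙ (parity n)))

n+2≡₂n : ∀ n → n + 2 ≡₂ n
n+2≡₂n n = ≡₂-trans (≡₂-+ (≡₂-refl {n}) (n+n≡₂0 1)) (≡⇒≡₂ (+-identityʳ n))

≡₂-respˡ : ∀ {a b c} → a ≡₂ b → (a ≡₂ c ⇔ b ≡₂ c)
≡₂-respˡ a≡₂b = mk⇔ (≡₂-trans (≡₂-sym a≡₂b)) (≡₂-trans a≡₂b)

≡₂-respʳ : ∀ {a b c} → b ≡₂ c → (a ≡₂ b ⇔ a ≡₂ c)
≡₂-respʳ b≡₂c = mk⇔ (λ a≡₂b → ≡₂-trans a≡₂b b≡₂c) (λ a≡₂c → ≡₂-trans a≡₂c (≡₂-sym b≡₂c))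

_≟₂_ : ∀ m n → Dec (m ≡₂ n)
m ≟₂ n = Dec.map′ mk≡₂ parity≡ (parity m ℙ.≟ parity n)

-- a = c - b, and -b ≡ b (mod 2)
+≡⇒≡₂ : ∀ {a b c} → a + b ≡ c → a ≡₂ b + c
+≡⇒≡₂ {a} {b} refl = begin
  a            ≡⟨ +-identityʳ a ⟨
  a + 0        ≈⟨ ≡₂-+ (≡₂-refl {a}) (≡₂-sym (n+n≡₂0 b)) ⟩
  a + (b + b)  ≡⟨ rearrange a b ⟩
  b + (a + b)  ∎
  where
    open ≈-Reasoning ≡₂-setoid
    rearrange : ∀ a b → a + (b + b) ≡ b + (a + b)
    rearrange = solve-∀

parity-suc : ∀ n → parity (suc n) ≡ parity n ⁻¹
parity-suc n = trans (sym (ℙ.⁻¹-involutive _)) (cong _⁻¹ (ℙ.suc-homo-⁻¹ n))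

suc≢₂ : ∀ n → ¬ (suc n ≡₂ n)
suc≢₂ n (mk≡₂ e) = ℙ.p≢p⁻¹ (parity n) (trans (sym e) (parity-suc n))

≢₂⇒suc≡₂ : ∀ {m n} → ¬ (m ≡₂ n) → suc m ≡₂ n
≢₂⇒suc≡₂ {m} {n} m≢₂n = mk≡₂ (trans (parity-suc m) (flip (parity m) (parity n) (m≢₂n ∘ mk≡₂)))
  where
    flip : ∀ p q → p ≢ q → p ⁻¹ ≡ q
    flip 0ℙ 0ℙ p≢q = contradiction refl p≢q
    flip 0ℙ 1ℙ _ = refl
    flip 1ℙ 0ℙ _ = refl
    flip 1ℙ 1ℙ p≢q = contradiction refl p≢q

-- Lists of parts

sumL-++ : ∀ xs ys → sumL (xs ++ ys) ≡ sumL xs + sumL ys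
sumL-++ [] ys = refl
sumL-++ (x ∷ xs) ys = trans (cong (x +_) (sumL-++ xs ys)) (sym (+-assoc x _ _))

sumL-replicate : ∀ n x → sumL (replicate n x) ≡ n * x
sumL-replicate zero x = refl
sumL-replicate (suc n) x = cong (x +_) (sumL-replicate n x)

sumL-replicate-++ : ∀ m p ys {n} → sumL (replicate m p ++ ys) ≡ n → m * p ≤ n × sumL ys ≡ n ∸ m * p
sumL-replicate-++ m p ys refl = subst (m * p ≤_) (sym sum≡) (m≤m+n (m * p) (sumL ys)) ,
                                sym (trans (cong (_∸ m * p) sum≡) (m+n∸m≡n (m * p) (sumL ys)))
  where
    sum≡ : sumL (replicate m p ++ ys) ≡ m * p + sumL ys
    sum≡ = trans (sumL-++ (replicate m p) ys) (cong (_+ sumL ys) (sumL-replicate m p))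

mult-++ : ∀ p xs ys → mult p (xs ++ ys) ≡ mult p xs + mult p ys
mult-++ p [] ys = refl
mult-++ p (x ∷ xs) ys = trans (cong (_ +_) (mult-++ p xs ys)) (sym (+-assoc (if ⌊ x ≟ p ⌋ then 1 else 0) _ _))

mult-replicate : ∀ n p → mult p (replicate n p) ≡ n
mult-replicate zero p = refl
mult-replicate (suc n) p with p ≟ p
... | yes _ = cong suc (mult-replicate n p)
... | no p≢p = contradiction refl p≢p

mult-replicate-≢ : ∀ n {p x} → x ≢ p → mult p (replicate n x) ≡ 0
mult-replicate-≢ zero x≢p = refl
mult-replicate-≢ (suc n) {p} {x} x≢p with x ≟ p
... | yes x≡p = contradiction x≡p x≢p
... | no _ = mult-replicate-≢ n x≢p

mult-<-all : ∀ {p} xs → All (_< p) xs → mult p xs ≡ 0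
mult-<-all [] [] = refl
mult-<-all {p} (x ∷ xs) (x<p ∷ xs<p) with x ≟ p
... | yes refl = contradiction x<p (<-irrefl refl)
... | no _ = mult-<-all xs xs<p

≤-all⇒<-all : ∀ {p} xs → All (_≤ p) xs → mult p xs ≡ 0 → All (_< p) xs
≤-all⇒<-all [] [] _ = []
≤-all⇒<-all {p} (x ∷ xs) (x≤p ∷ xs≤p) mult≡0 with x ≟ p
... | no x≢p = ≤∧≢⇒< x≤p x≢p ∷ ≤-all⇒<-all xs xs≤p mult≡0

mult-replicate-++ : ∀ m p {ys} → All (_< p) ys → mult p (replicate m p ++ ys) ≡ m
mult-replicate-++ m p {ys} ys<p = begin
  mult p (replicate m p ++ ys)               ≡⟨ mult-++ p (replicate m p) ys ⟩
  mult p (replicate m p) + mult p ys         ≡⟨ cong₂ _+_ (mult-replicate m p) (mult-<-all ys ys<p) ⟩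
  m + 0                                      ≡⟨ +-identityʳ m ⟩
  m                                          ∎
  where open ≡-Reasoning

mult-replicate-++-≢ : ∀ m {p x} ys → p ≢ x → mult x (replicate m p ++ ys) ≡ mult x ys
mult-replicate-++-≢ m {p} {x} ys p≢x =
  trans (mult-++ x (replicate m p) ys) (cong (_+ mult x ys) (mult-replicate-≢ m p≢x))

replicate-++-injective : ∀ {m₁ m₂ p ys₁ ys₂} → All (_< p) ys₁ → All (_< p) ys₂ →
                         replicate m₁ p ++ ys₁ ≡ replicate m₂ p ++ ys₂ → m₁ ≡ m₂ × ys₁ ≡ ys₂
replicate-++-injective {m₁} {m₂} {p} {ys₁} {ys₂} ys₁<p ys₂<p e = m₁≡m₂ , ++-cancelˡ (replicate m₁ p) ys₁ ys₂ e′
  where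
    m₁≡m₂ : m₁ ≡ m₂
    m₁≡m₂ = trans (sym (mult-replicate-++ m₁ p ys₁<p)) (trans (cong (mult p) e) (mult-replicate-++ m₂ p ys₂<p))
    e′ : replicate m₁ p ++ ys₁ ≡ replicate m₁ p ++ ys₂
    e′ = trans e (cong (λ m → replicate m p ++ ys₂) (sym m₁≡m₂))

part-∷ : ∀ x xs {s} → 1 ≤ s → part (x ∷ xs) (suc s) ≡ part xs s
part-∷ x [] {suc zero} _ = refl
part-∷ x [] {suc (suc s)} _ = refl
part-∷ x (y ∷ xs) {suc s} _ = refl

part-++ˡ : ∀ xs ys {s} → s ≤ length xs → part (xs ++ ys) s ≡ part xs s
part-++ˡ [] [] {zero} _ = refl
part-++ˡ [] (y ∷ ys) {zero} _ = refl
part-++ˡ (x ∷ xs) ys {zero} _ = refl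
part-++ˡ (x ∷ xs) ys {suc zero} _ = refl
part-++ˡ (x ∷ xs) ys {suc (suc s)} (s≤s s<∣xs∣) = begin
  part (x ∷ xs ++ ys) (suc (suc s))  ≡⟨ part-∷ x (xs ++ ys) (s≤s z≤n) ⟩
  part (xs ++ ys) (suc s)            ≡⟨ part-++ˡ xs ys s<∣xs∣ ⟩
  part xs (suc s)                    ≡⟨ part-∷ x xs (s≤s z≤n) ⟨
  part (x ∷ xs) (suc (suc s))        ∎
  where open ≡-Reasoning

part-++ʳ : ∀ xs ys s → part (xs ++ ys) (length xs + suc s) ≡ part ys (suc s)
part-++ʳ [] ys s = refl
part-++ʳ (x ∷ xs) ys s =
  trans (part-∷ x (xs ++ ys) (subst (1 ≤_) (sym (+-suc (length xs) s)) (s≤s z≤n))) (part-++ʳ xs ys s)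

All-part : ∀ {P : ℕ → Set} xs {s} → All P xs → 1 ≤ s → s ≤ length xs → P (part xs s)
All-part (x ∷ xs) {suc zero} (px ∷ _) _ _ = px
All-part (x ∷ xs) {suc (suc s)} (_ ∷ pxs) _ (s≤s s<∣xs∣) = All-part xs pxs (s≤s z≤n) s<∣xs∣

windowSum-∷ : ∀ x xs {t} r → 1 ≤ t → windowSum (x ∷ xs) (suc t) r ≡ windowSum xs t r
windowSum-∷ x xs zero 1≤t = part-∷ x xs 1≤t
windowSum-∷ x xs {t} (suc r) 1≤t =
  cong₂ _+_ (windowSum-∷ x xs r 1≤t) (part-∷ x xs (≤-trans 1≤t (m≤m+n t (suc r))))

sumL-take-suc : ∀ π n → sumL (take (suc n) π) ≡ sumL (take n π) + part π (suc n)
sumL-take-suc [] zero = refl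
sumL-take-suc [] (suc n) = refl
sumL-take-suc (x ∷ xs) zero = +-comm x 0
sumL-take-suc (x ∷ xs) (suc n) = begin
  x + sumL (take (suc n) xs)                   ≡⟨ cong (x +_) (sumL-take-suc xs n) ⟩
  x + (sumL (take n xs) + part xs (suc n))     ≡⟨ cong (λ y → x + (sumL (take n xs) + y)) (part-∷ x xs (s≤s z≤n)) ⟨
  x + (sumL (take n xs) + part (x ∷ xs) (suc (suc n)))  ≡⟨ +-assoc x _ _ ⟨
  x + sumL (take n xs) + part (x ∷ xs) (suc (suc n))    ∎
  where open ≡-Reasoning

windowSum≡sumL-take : ∀ π r → windowSum π 1 r ≡ sumL (take (suc r) π)
windowSum≡sumL-take π zero = sym (sumL-take-suc π 0)
windowSum≡sumL-take π (suc r) =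
  trans (cong (_+ part π (2 + r)) (windowSum≡sumL-take π r)) (sym (sumL-take-suc π (suc r)))

take-length-++ : ∀ (xs ys : List ℕ) → take (length xs) (xs ++ ys) ≡ xs
take-length-++ [] ys = refl
take-length-++ (x ∷ xs) ys = cong (x ∷_) (take-length-++ xs ys)

Nonincreasing-tail : ∀ {x xs} → Nonincreasing (x ∷ xs) → Nonincreasing xs
Nonincreasing-tail ni-[x] = ni-[]
Nonincreasing-tail (ni-∷ _ ni) = ni

Nonincreasing⇒≤head : ∀ {x xs} → Nonincreasing (x ∷ xs) → All (_≤ x) xs
Nonincreasing⇒≤head ni-[x] = []
Nonincreasing⇒≤head (ni-∷ y≤x ni) = y≤x ∷ All.map (λ z≤y → ≤-trans z≤y y≤x) (Nonincreasing⇒≤head ni)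

Nonincreasing-∷ : ∀ {x xs} → All (_≤ x) xs → Nonincreasing xs → Nonincreasing (x ∷ xs)
Nonincreasing-∷ [] ni-[] = ni-[x]
Nonincreasing-∷ (y≤x ∷ _) ni = ni-∷ y≤x ni

Nonincreasing-++⁻ʳ : ∀ xs {ys} → Nonincreasing (xs ++ ys) → Nonincreasing ys
Nonincreasing-++⁻ʳ [] ni = ni
Nonincreasing-++⁻ʳ (x ∷ xs) ni = Nonincreasing-++⁻ʳ xs (Nonincreasing-tail ni)

Nonincreasing-replicate-++ : ∀ n {x ys} → All (_≤ x) ys → Nonincreasing ys → Nonincreasing (replicate n x ++ ys)
Nonincreasing-replicate-++ zero ys≤x ni = ni
Nonincreasing-replicate-++ (suc n) {x} {ys} ys≤x ni =
  Nonincreasing-∷ (++⁺ (replicate⁺ n ≤-refl) ys≤x) (Nonincreasing-replicate-++ n ys≤x ni)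

splitTop : ∀ q ys → Nonincreasing ys → All (_≤ q) ys →
           ∃ λ a → ∃ λ zs → ys ≡ replicate a q ++ zs × All (_< q) zs
splitTop q [] _ _ = 0 , [] , refl , []
splitTop q (y ∷ ys) ni (y≤q ∷ ys≤q) with y ≟ q
... | yes refl = let (a , zs , e , zs<q) = splitTop q ys (Nonincreasing-tail ni) ys≤q in
                 suc a , zs , cong (q ∷_) e , zs<q
... | no y≢q = 0 , y ∷ ys , refl , y<q ∷ All.map (λ z≤y → <-≤-trans (s≤s z≤y) y<q) (Nonincreasing⇒≤head ni)
  where y<q = ≤∧≢⇒< y≤q y≢q

-- Conditions (1) and (6) for k = k0 + 2, with windows indexed from 0

module Windows (k0 : ℕ) where

  Spread : List ℕ → Set
  Spread π = ∀ t → t + suc (suc k0) ≤ length π → 2 + part π (t + suc (suc k0)) ≤ part π (suc t)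

  ParityRule : ℕ → List ℕ → Set
  ParityRule c π = ∀ t → t + suc k0 ≤ length π → part π (suc t) ≤ 1 + part π (t + suc k0) →
                   windowSum π (suc t) k0 + suc (suc k0) ≡₂ c

  private
    1≤+suc : ∀ a b → 1 ≤ a + suc b
    1≤+suc a b = subst (1 ≤_) (sym (+-suc a b)) (s≤s z≤n)

  Spread-∷⁻ : ∀ x xs → Spread (x ∷ xs) → Spread xs
  Spread-∷⁻ x xs spread t t+k≤∣xs∣ =
    subst (λ y → 2 + y ≤ part xs (suc t)) (part-∷ x xs (1≤+suc t (suc k0))) (spread (suc t) (s≤s t+k≤∣xs∣))

  Spread-∷⁺ : ∀ x xs → (suc (suc k0) ≤ length (x ∷ xs) → 2 + part (x ∷ xs) (suc (suc k0)) ≤ x) →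
              Spread xs → Spread (x ∷ xs)
  Spread-∷⁺ x xs head spread zero k≤∣π∣ = head k≤∣π∣
  Spread-∷⁺ x xs head spread (suc t) (s≤s t+k≤∣xs∣) =
    subst (λ y → 2 + y ≤ part xs (suc t)) (sym (part-∷ x xs (1≤+suc t (suc k0)))) (spread t t+k≤∣xs∣)

  Spread-++⁻ʳ : ∀ xs {ys} → Spread (xs ++ ys) → Spread ys
  Spread-++⁻ʳ [] spread = spread
  Spread-++⁻ʳ (x ∷ xs) spread = Spread-++⁻ʳ xs (Spread-∷⁻ x (xs ++ _) spread)

  ParityRule-∷⁻ : ∀ c x xs → ParityRule c (x ∷ xs) → ParityRule c xs
  ParityRule-∷⁻ c x xs rule t t+k-1≤∣xs∣ first≤1+last =
    subst (λ s → s + suc (suc k0) ≡₂ c) (windowSum-∷ x xs k0 (s≤s z≤n))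
      (rule (suc t) (s≤s t+k-1≤∣xs∣)
        (subst (λ y → part xs (suc t) ≤ 1 + y) (sym (part-∷ x xs (1≤+suc t k0))) first≤1+last))

  ParityRule-∷⁺ : ∀ c x xs →
                  (suc k0 ≤ length (x ∷ xs) → x ≤ 1 + part (x ∷ xs) (suc k0) →
                   windowSum (x ∷ xs) 1 k0 + suc (suc k0) ≡₂ c) →
                  ParityRule c xs → ParityRule c (x ∷ xs)
  ParityRule-∷⁺ c x xs head rule zero = head
  ParityRule-∷⁺ c x xs head rule (suc t) (s≤s t+k-1≤∣xs∣) first≤1+last =
    subst (λ s → s + suc (suc k0) ≡₂ c) (sym (windowSum-∷ x xs k0 (s≤s z≤n)))
      (rule t t+k-1≤∣xs∣ (subst (λ y → part xs (suc t) ≤ 1 + y) (part-∷ x xs (1≤+suc t k0)) first≤1+last))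

  ParityRule-++⁻ʳ : ∀ c xs {ys} → ParityRule c (xs ++ ys) → ParityRule c ys
  ParityRule-++⁻ʳ c [] rule = rule
  ParityRule-++⁻ʳ c (x ∷ xs) rule = ParityRule-++⁻ʳ c xs (ParityRule-∷⁻ c x (xs ++ _) rule)

  ParityRule-cong : ∀ {c c′ π} → c ≡₂ c′ → ParityRule c π → ParityRule c′ π
  ParityRule-cong c≡₂c′ rule t t+k-1≤∣π∣ first≤1+last = ≡₂-trans (rule t t+k-1≤∣π∣ first≤1+last) c≡₂c′

  Spread-[] : Spread []
  Spread-[] t t+k≤0 = contradiction (subst (_≤ 0) (+-suc t (suc k0)) t+k≤0) λ ()

  ParityRule-[] : ∀ c → ParityRule c []
  ParityRule-[] c t t+k-1≤0 = contradiction (subst (_≤ 0) (+-suc t k0) t+k-1≤0) λ ()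

  module Blocks (q : ℕ) (zs : List ℕ) (zs<q : All (_< q) zs) where

    top : ℕ → ℕ → List ℕ
    top M a = replicate M (suc q) ++ replicate a q

    blocks : ℕ → ℕ → List ℕ
    blocks M a = replicate M (suc q) ++ replicate a q ++ zs

    blocks≡top++ : ∀ M a → blocks M a ≡ top M a ++ zs
    blocks≡top++ M a = sym (++-assoc (replicate M (suc q)) (replicate a q) zs)

    length-top : ∀ M a → length (top M a) ≡ M + a
    length-top M a = trans (length-++ (replicate M (suc q))) (cong₂ _+_ (length-replicate M) (length-replicate a))

    length-blocks : ∀ M a → length (blocks M a) ≡ M + a + length zs
    length-blocks M a = trans (cong length (blocks≡top++ M a))
                              (trans (length-++ (top M a)) (cong (_+ length zs) (length-top M a)))

    blocks≤1+q : ∀ M a → All (_≤ suc q) (blocks M a)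
    blocks≤1+q M a = ++⁺ (replicate⁺ M ≤-refl) (++⁺ (replicate⁺ a (n≤1+n q)) (All.map <⇒≤ (All.map m<n⇒m<1+n zs<q)))

    part-blocks-≥ : ∀ M a {s} → 1 ≤ s → s ≤ M + a → q ≤ part (blocks M a) s
    part-blocks-≥ M a {s} 1≤s s≤M+a =
      subst (q ≤_) (sym (trans (cong (λ π → part π s) (blocks≡top++ M a)) (part-++ˡ (top M a) zs s≤∣top∣)))
        (All-part {q ≤_} (top M a) (++⁺ (replicate⁺ M (n≤1+n q)) (replicate⁺ a ≤-refl)) 1≤s s≤∣top∣)
      where s≤∣top∣ = subst (s ≤_) (sym (length-top M a)) s≤M+a

    part-blocks-< : ∀ M a {s} → M + a < s → s ≤ length (blocks M a) → part (blocks M a) s < q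
    part-blocks-< M a {s} M+a<s s≤∣π∣ with m≤n⇒∃[o]m+o≡n M+a<s
    ... | s′ , refl = subst (_< q) (sym part≡) (All-part zs zs<q (s≤s z≤n) 1+s′≤∣zs∣)
      where
        part≡ : part (blocks M a) (suc (M + a) + s′) ≡ part zs (suc s′)
        part≡ = begin
          part (blocks M a) (suc (M + a) + s′)
            ≡⟨ cong₂ part (blocks≡top++ M a) (sym (+-suc (M + a) s′)) ⟩
          part (top M a ++ zs) (M + a + suc s′)
            ≡⟨ cong (λ n → part (top M a ++ zs) (n + suc s′)) (length-top M a) ⟨
          part (top M a ++ zs) (length (top M a) + suc s′)
            ≡⟨ part-++ʳ (top M a) zs s′ ⟩
          part zs (suc s′)
            ∎
          where open ≡-Reasoning
        1+s′≤∣zs∣ : suc s′ ≤ length zs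
        1+s′≤∣zs∣ = +-cancelˡ-≤ (M + a) _ _
          (subst (_≤ M + a + length zs) (sym (+-suc (M + a) s′))
            (subst (suc (M + a) + s′ ≤_) (length-blocks M a) s≤∣π∣))

    windowSum-blocks : ∀ M a → M + a ≡ suc k0 → windowSum (blocks M a) 1 k0 ≡ suc k0 * q + M
    windowSum-blocks M a M+a≡k-1 = begin
      windowSum (blocks M a) 1 k0
        ≡⟨ windowSum≡sumL-take (blocks M a) k0 ⟩
      sumL (take (suc k0) (blocks M a))
        ≡⟨ cong₂ (λ n π → sumL (take n π)) (trans (sym M+a≡k-1) (sym (length-top M a))) (blocks≡top++ M a) ⟩
      sumL (take (length (top M a)) (top M a ++ zs))
        ≡⟨ cong sumL (take-length-++ (top M a) zs) ⟩
      sumL (replicate M (suc q) ++ replicate a q)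
        ≡⟨ sumL-++ (replicate M (suc q)) (replicate a q) ⟩
      sumL (replicate M (suc q)) + sumL (replicate a q)
        ≡⟨ cong₂ _+_ (sumL-replicate M (suc q)) (sumL-replicate a q) ⟩
      M * suc q + a * q
        ≡⟨ rearrange M a q ⟩
      (M + a) * q + M
        ≡⟨ cong (λ n → n * q + M) M+a≡k-1 ⟩
      suc k0 * q + M
        ∎
      where
        open ≡-Reasoning
        rearrange : ∀ M a q → M * suc q + a * q ≡ (M + a) * q + M
        rearrange = solve-∀

    first-blocks≤1+q : ∀ M a → 1 ≤ length (blocks M a) → part (blocks M a) 1 ≤ suc q
    first-blocks≤1+q M a = All-part (blocks M a) (blocks≤1+q M a) (s≤s z≤n)

    k-1≤length-blocks : ∀ M a → M + a ≡ suc k0 → suc k0 ≤ length (blocks M a)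
    k-1≤length-blocks M a M+a≡k-1 =
      subst (_≤ length (blocks M a)) M+a≡k-1 (subst (M + a ≤_) (sym (length-blocks M a)) (m≤m+n (M + a) _))

    Spread-blocks-bound : ∀ M a → Spread (blocks M a) → M + a ≤ suc k0
    Spread-blocks-bound M a spread with M + a ≤? suc k0
    ... | yes M+a≤k-1 = M+a≤k-1
    ... | no M+a≰k-1 = contradiction (≤-trans (s≤s (s≤s q≤last)) (≤-trans (spread 0 k≤∣π∣) first≤1+q)) 1+n≰n
      where
        k≤M+a = ≰⇒> M+a≰k-1
        k≤∣π∣ = ≤-trans k≤M+a (subst (M + a ≤_) (sym (length-blocks M a)) (m≤m+n (M + a) _))
        q≤last = part-blocks-≥ M a (s≤s z≤n) k≤M+a
        first≤1+q = first-blocks≤1+q M a (≤-trans (s≤s z≤n) k≤∣π∣)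

    Spread-blocks : ∀ M a → Spread (blocks 0 a) → M + a ≤ suc k0 → Spread (blocks M a)
    Spread-blocks zero a spread _ = spread
    Spread-blocks (suc M) a spread 1+M+a≤k-1 =
      Spread-∷⁺ (suc q) (blocks M a) (λ k≤∣π∣ → s≤s (part-blocks-< (suc M) a (s≤s 1+M+a≤k-1) k≤∣π∣))
        (Spread-blocks M a spread (≤-trans (n≤1+n _) 1+M+a≤k-1))

    topWindow : ∀ c M a → M + a ≡ suc k0 → ParityRule c (blocks M a) → suc k0 * q + M + suc (suc k0) ≡₂ c
    topWindow c M a M+a≡k-1 rule =
      subst (λ s → s + suc (suc k0) ≡₂ c) (windowSum-blocks M a M+a≡k-1)
        (rule 0 k-1≤∣π∣ (≤-trans (first-blocks≤1+q M a (≤-trans (s≤s z≤n) k-1≤∣π∣)) (s≤s q≤last)))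
      where
        k-1≤∣π∣ = k-1≤length-blocks M a M+a≡k-1
        q≤last = part-blocks-≥ M a (s≤s z≤n) (≤-reflexive (sym M+a≡k-1))

    ParityRule-blocks : ∀ c M a → ParityRule c (blocks 0 a) → M + a ≤ suc k0 →
                        (1 ≤ M → M + a ≡ suc k0 → suc k0 * q + M + suc (suc k0) ≡₂ c) →
                        ParityRule c (blocks M a)
    ParityRule-blocks c zero a rule _ _ = rule
    ParityRule-blocks c (suc M) a rule 1+M+a≤k-1 top =
      ParityRule-∷⁺ c (suc q) (blocks M a) head
        (ParityRule-blocks c M a rule (≤-trans (n≤1+n _) 1+M+a≤k-1)
          (λ _ M+a≡k-1 → contradiction (subst (λ n → suc n ≤ suc k0) M+a≡k-1 1+M+a≤k-1) 1+n≰n))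
      where
        head : suc k0 ≤ length (blocks (suc M) a) → suc q ≤ 1 + part (blocks (suc M) a) (suc k0) →
               windowSum (blocks (suc M) a) 1 k0 + suc (suc k0) ≡₂ c
        head k-1≤∣π∣ first≤1+last with suc M + a ≟ suc k0
        ... | yes e = subst (λ s → s + suc (suc k0) ≡₂ c) (sym (windowSum-blocks (suc M) a e)) (top (s≤s z≤n) e)
        ... | no ≢k-1 = contradiction (≤-pred first≤1+last)
                          (<⇒≱ (part-blocks-< (suc M) a (≤∧≢⇒< 1+M+a≤k-1 ≢k-1) k-1≤∣π∣))

-- The partitions counted by h

JustBelow : ℕ → ℕ → Set
JustBelow m l = m + 2 ≡ l ⊎ m + 1 ≡ l

JustBelow⇒< : ∀ {m l} → JustBelow m l → m < l
JustBelow⇒< (inj₁ refl) = m<m+n _ z<s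
JustBelow⇒< (inj₂ refl) = m<m+n _ z<s

JustBelow-1 : ∀ {m} → JustBelow m 1 → m ≡ 0
JustBelow-1 {zero} _ = refl
JustBelow-1 {suc m} (inj₁ e) = contradiction (suc-injective e) (m+1+n≢0 m)
JustBelow-1 {suc m} (inj₂ e) = contradiction (suc-injective e) (m+1+n≢0 m)

JustBelow-2+ : ∀ {m l} → JustBelow m (2 + l) ⇔ (m ≡ l ⊎ m ≡ suc l)
JustBelow-2+ {m} {l} = mk⇔
  (Sum.map (λ e → +-cancelʳ-≡ 2 m l (trans e (+-comm 2 l)))
           (λ e → +-cancelʳ-≡ 1 m (suc l) (trans e (+-comm 1 (suc l)))))
  (Sum.map (λ { refl → +-comm l 2 }) (λ { refl → +-comm (suc l) 1 }))

JustBelow-determined : ∀ {a t₁ t₂} → JustBelow a t₁ → JustBelow a t₂ → t₁ ≡₂ t₂ → t₁ ≡ t₂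
JustBelow-determined (inj₁ refl) (inj₁ refl) _ = refl
JustBelow-determined (inj₂ refl) (inj₂ refl) _ = refl
JustBelow-determined {a} (inj₁ refl) (inj₂ refl) e = contradiction (a+2≡₂a+1 e) (suc≢₂ (suc a))
  where a+2≡₂a+1 = λ e → ≡₂-trans (≡⇒≡₂ (+-comm 2 a)) (≡₂-trans e (≡⇒≡₂ (+-comm a 1)))
JustBelow-determined {a} (inj₂ refl) (inj₁ refl) e = contradiction (a+2≡₂a+1 (≡₂-sym e)) (suc≢₂ (suc a))
  where a+2≡₂a+1 = λ e → ≡₂-trans (≡⇒≡₂ (+-comm 2 a)) (≡₂-trans e (≡⇒≡₂ (+-comm a 1)))

JustBelow-bound : ∀ {m a l N} → JustBelow m l → m + a ≤ N → ¬ (m + 2 ≡ l × m + a ≡ N) → a + l ≤ suc N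
JustBelow-bound {m} {a} {N = N} (inj₂ refl) m+a≤N _ = subst (_≤ suc N) (rearrange m a) (s≤s m+a≤N)
  where
    rearrange : ∀ m a → suc (m + a) ≡ a + (m + 1)
    rearrange = solve-∀
JustBelow-bound {m} {a} {N = N} (inj₁ refl) m+a≤N not-top =
  subst (_≤ suc N) (rearrange m a) (s≤s (≤∧≢⇒< m+a≤N (λ m+a≡N → not-top (refl , m+a≡N))))
  where
    rearrange : ∀ m a → suc (suc (m + a)) ≡ a + (m + 2)
    rearrange = solve-∀

<+<-bound : ∀ {m l a t N} → m < l → a < t → t + l ≤ suc (suc N) → m + a ≤ N
<+<-bound {m} {l} {a} {t} m<l a<t t+l≤ = ≤-pred (≤-pred (begin
  suc (suc (m + a))  ≡⟨ cong suc (+-suc m a) ⟨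
  suc m + suc a      ≤⟨ +-mono-≤ m<l a<t ⟩
  l + t              ≡⟨ +-comm l t ⟩
  t + l              ≤⟨ t+l≤ ⟩
  _                  ∎))
  where open ≤-Reasoning

JustBelow-top : ∀ {m l a t N} → JustBelow m l → a < t → t + l ≤ suc (suc N) → m + a ≡ N → m + 1 ≡ l
JustBelow-top (inj₂ m+1≡l) _ _ _ = m+1≡l
JustBelow-top {m} {a = a} (inj₁ refl) a<t t+l≤ m+a≡N =
  contradiction (subst (suc m + a ≤_) (sym m+a≡N) (<+<-bound (subst (suc m <_) (+-comm 2 m) ≤-refl) a<t t+l≤)) 1+n≰n

choose-t : ∀ a l N → a + l ≤ N → ∃ λ t → JustBelow a t × t ≡₂ l + N + 1 × t + l ≤ suc N
choose-t a l N a+l≤N with suc a ≟₂ (l + N + 1)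
... | yes 1+a≡₂ = suc a , inj₂ (+-comm a 1) , 1+a≡₂ , s≤s a+l≤N
... | no 1+a≢₂ = suc (suc a) , inj₁ (+-comm a 2) , ≢₂⇒suc≡₂ 1+a≢₂ , s≤s (≤∧≢⇒< a+l≤N a+l≢N)
  where
    a+l≢N : a + l ≢ N
    a+l≢N a+l≡N = 1+a≢₂ (≡₂-trans (≡₂-+ (≡₂-refl {1}) (+≡⇒≡₂ a+l≡N)) (≡⇒≡₂ (+-comm 1 (l + N))))

module Partitions (k0 J i : ℕ) where

  open Windows k0

  private
    k : ℕ
    k = suc (suc k0)

  record Admissible (j l n : ℕ) (π : List ℕ) : Set where
    field
      nonincreasing : Nonincreasing π
      sum≡ : sumL π ≡ n
      parts≤ : All (_≤ j) π
      parts> : All (J <_) π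
      spread : Spread π
      parityRule : ParityRule (suc k0 * j + l) π
      mult-top : JustBelow (mult j π) l
      mult-bottom : mult (J + 1) π ≤ k ∸ i

  private
    first≤⇒All≤ : ∀ {j} π → Nonincreasing π → (∀ r → length π ≡ suc r → part π 1 ≤ j) → All (_≤ j) π
    first≤⇒All≤ [] _ _ = []
    first≤⇒All≤ (x ∷ xs) ni first≤j = x≤j ∷ All.map (λ y≤x → ≤-trans y≤x x≤j) (Nonincreasing⇒≤head ni)
      where x≤j = first≤j (length xs) refl

    last>⇒All> : ∀ π → Nonincreasing π → (∀ r → length π ≡ suc r → J < part π (suc r)) → All (J <_) π
    last>⇒All> [] _ _ = []
    last>⇒All> (x ∷ []) _ last> = last> 0 refl ∷ []
    last>⇒All> (x ∷ y ∷ ys) (ni-∷ y≤x ni) last>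
      with last>⇒All> (y ∷ ys) ni (λ r e → last> (suc r) (cong suc e))
    ... | J<y ∷ J<ys = <-≤-trans J<y y≤x ∷ J<y ∷ J<ys

    window-end : ∀ t → suc t + k ∸ 2 ≡ t + suc k0
    window-end t = cong (_∸ 1) (+-suc t (suc k0))

  Admissible⇔ : ∀ j l n π → (IsPartition n π × Conditions k J i j l π) ⇔ Admissible j l n π
  Admissible⇔ j l n π = mk⇔ to′ from′
    where
      to′ : IsPartition n π × Conditions k J i j l π → Admissible j l n π
      to′ ((ni , _ , sum≡) , c1 , c2 , c3 , c4 , c5 , c6) = record
        { nonincreasing = ni
        ; sum≡ = sum≡
        ; parts≤ = first≤⇒All≤ π ni c2
        ; parts> = last>⇒All> π ni c4
        ; spread = λ t → c1 (suc t) (s≤s z≤n)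
        ; parityRule = λ t t+k-1≤∣π∣ first≤1+last →
            to (%2≡⇔≡₂ _ _) (c6 (suc t) (s≤s z≤n)
              (subst (_≤ length π) (sym (window-end t)) t+k-1≤∣π∣)
              (subst (λ s → part π (suc t) ≤ 1 + part π s) (sym (window-end t)) first≤1+last))
        ; mult-top = c3
        ; mult-bottom = c5
        }
      from′ : Admissible j l n π → IsPartition n π × Conditions k J i j l π
      from′ adm =
        (nonincreasing , All.map (<-≤-trans z<s) parts> , sum≡) ,
        (λ { (suc t) _ → spread t }) ,
        (λ r ∣π∣≡1+r → All-part π parts≤ (s≤s z≤n) (subst (1 ≤_) (sym ∣π∣≡1+r) (s≤s z≤n))) ,
        mult-top ,
        (λ r ∣π∣≡1+r → All-part π parts> (s≤s z≤n) (≤-reflexive (sym ∣π∣≡1+r))) ,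
        mult-bottom ,
        (λ { (suc t) _ t+k-1≤∣π∣ first≤1+last →
            from (%2≡⇔≡₂ _ _) (parityRule t
              (subst (_≤ length π) (window-end t) t+k-1≤∣π∣)
              (subst (λ s → part π (suc t) ≤ 1 + part π s) (window-end t) first≤1+last)) })
        where open Admissible adm

  -- i and d determine the parity of every l with h^{(J+d)}_{i,l} ≠ 0
  Compatible : ℕ → ℕ → Set
  Compatible d l = l + d * suc k ≡₂ i

  Compatible-step : ∀ {d l t} → t ≡₂ l + k + 1 → Compatible (suc d) l ⇔ Compatible d t
  Compatible-step {d} {l} {t} t≡₂ = ≡₂-respˡ (begin
    l + suc d * suc k          ≡⟨ rearrange l d k ⟩
    (l + k + 1) + d * suc k    ≈⟨ ≡₂-+ (≡₂-sym t≡₂) (≡₂-refl {d * suc k}) ⟩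
    t + d * suc k              ∎)
    where
      open ≈-Reasoning ≡₂-setoid
      rearrange : ∀ l d k → l + suc d * suc k ≡ (l + k + 1) + d * suc k
      rearrange = solve-∀

  Compatible-one : ∀ {l} → Compatible 1 l → i ≡₂ l + k + 1
  Compatible-one {l} compat = ≡₂-trans (≡₂-sym compat) (≡⇒≡₂ (rearrange l k))
    where
      rearrange : ∀ l k → l + 1 * suc k ≡ l + k + 1
      rearrange = solve-∀

  Compatible⇔-odd : ∀ d l → k ≡₂ 1 → Compatible d l ⇔ l ≡₂ i
  Compatible⇔-odd d l k≡₂1 = ≡₂-respˡ (begin
    l + d * suc k  ≈⟨ ≡₂-+ (≡₂-refl {l}) (≡₂-*ˡ d (≡₂-trans (≡₂-+ (≡₂-refl {1}) k≡₂1) (n+n≡₂0 1))) ⟩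
    l + d * 0      ≡⟨ cong (l +_) (*-zeroʳ d) ⟩
    l + 0          ≡⟨ +-identityʳ l ⟩
    l              ∎)
    where open ≈-Reasoning ≡₂-setoid

  Compatible⇔-even : ∀ d l → k ≡₂ 0 → Compatible d l ⇔ d + l ≡₂ i
  Compatible⇔-even d l k≡₂0 = ≡₂-respˡ (begin
    l + d * suc k  ≈⟨ ≡₂-+ (≡₂-refl {l}) (≡₂-*ˡ d (≡₂-+ (≡₂-refl {1}) k≡₂0)) ⟩
    l + d * 1      ≡⟨ cong (l +_) (*-identityʳ d) ⟩
    l + d          ≡⟨ +-comm l d ⟩
    d + l          ∎)
    where open ≈-Reasoning ≡₂-setoid

  Compatible⇔%2 : ∀ d l → Compatible d l ⇔ ((k % 2 ≡ 1 → l % 2 ≡ i % 2) × (k % 2 ≡ 0 → (d + l) % 2 ≡ i % 2))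
  Compatible⇔%2 d l = mk⇔
    (λ c → (λ k-odd → from (%2≡⇔≡₂ l i) (to (Compatible⇔-odd d l (to (%2≡⇔≡₂ k 1) k-odd)) c)) ,
           (λ k-even → from (%2≡⇔≡₂ (d + l) i) (to (Compatible⇔-even d l (to (%2≡⇔≡₂ k 0) k-even)) c)))
    by-parity-of-k
    where
      by-parity-of-k : (k % 2 ≡ 1 → l % 2 ≡ i % 2) × (k % 2 ≡ 0 → (d + l) % 2 ≡ i % 2) → Compatible d l
      by-parity-of-k (odd-case , even-case) with parity k in eq
      ... | 1ℙ = from (Compatible⇔-odd d l (mk≡₂ eq))
                   (to (%2≡⇔≡₂ l i) (odd-case (from (%2≡⇔≡₂ k 1) (mk≡₂ eq))))
      ... | 0ℙ = from (Compatible⇔-even d l (mk≡₂ eq))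
                   (to (%2≡⇔≡₂ (d + l) i) (even-case (from (%2≡⇔≡₂ k 0) (mk≡₂ eq))))

  k≡₂1+k+1 : k ≡₂ 1 + k + 1
  k≡₂1+k+1 = ≡₂-sym (≡₂-trans (≡⇒≡₂ (sym (+-suc k 1))) (n+2≡₂n k))

  Hc-vanishes : ∀ d l → ¬ Compatible d l → ∀ n → Hc k J i d l n ≡ 0
  Hc-vanishes zero l incompatible n with l ≟ i
  ... | yes refl = contradiction (≡⇒≡₂ (+-identityʳ l)) incompatible
  ... | no _ = refl
  Hc-vanishes (suc d) zero _ n = refl
  Hc-vanishes (suc d) 1 incompatible n =
    sumFrom1-zero k _ λ t → if-zero {t % 2} {k % 2} _ λ t≡k →
      let t≡₂ = ≡₂-trans (to (%2≡⇔≡₂ t k) t≡k) k≡₂1+k+1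
      in Hc-vanishes d t (incompatible ∘ from (Compatible-step {d} {1} {t} t≡₂)) n
  Hc-vanishes (suc d) (suc (suc l′)) incompatible n =
    sumFrom1-zero (k ∸ l + 1) _ λ t → if-zero {t % 2} {(l + k + 1) % 2} _ λ t≡τ →
      let t≡₂ = to (%2≡⇔≡₂ t (l + k + 1)) t≡τ
          vanish = Hc-vanishes d t (incompatible ∘ from (Compatible-step {d} {l} {t} t≡₂))
      in cong₂ _+_ (shiftCoeff-zero (l′ * p) (Hc k J i d t) n vanish)
                   (shiftCoeff-zero (l′ * p + p) (Hc k J i d t) n vanish)
    where
      l = suc (suc l′)
      p = J + suc d

  -- the combinatorial reading of h^{(j+1)}_{i,l} = (1 + q^{j+1}) q^{(l-2)(j+1)} Σ_t h^{(j)}_{i,t}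
  Extension : (ℕ → ℕ → List ℕ → Set) → ℕ → ℕ → ℕ → List ℕ → Set
  Extension T p l n π =
    ∃ λ t → 1 ≤ t × t + l ≤ suc k × t ≡₂ l + k + 1 × ∃ λ m → JustBelow m l × Prepend (T t) p m n π

  module _ (d : ℕ) (T : ℕ → ℕ → List ℕ → Set)
           (T<p : ∀ {t n π} → T t n π → All (_< J + suc d) π)
           (T-determined : ∀ {t₁ t₂ n π} → T t₁ n π → T t₂ n π → t₁ ≡₂ t₂ → t₁ ≡ t₂) where

    private
      p : ℕ
      p = J + suc d

      Prepends : ℕ → ℕ → ℕ → List ℕ → Set
      Prepends l t n π = ∃ λ m → JustBelow m l × Prepend (T t) p m n π

      Prepend-determined : ∀ {t₁ t₂ m₁ m₂ n π} → Prepend (T t₁) p m₁ n π → Prepend (T t₂) p m₂ n π →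
                           t₁ ≡₂ t₂ → t₁ ≡ t₂
      Prepend-determined (π₁ , _ , x₁ , e₁) (π₂ , _ , x₂ , e₂) t₁≡₂t₂
        with replicate-++-injective (T<p x₁) (T<p x₂) (trans (sym e₁) e₂)
      ... | refl , refl = T-determined x₁ x₂ t₁≡₂t₂

      Prepends-count₁ : ∀ t n → HasCount (T t n) (Hc k J i d t n) → HasCount (Prepends 1 t n) (Hc k J i d t n)
      Prepends-count₁ t n = HasCount-cong (λ π → mk⇔ (λ x → 0 , inj₂ refl , π , z≤n , x , refl) drop) refl
        where
          drop : ∀ {π} → Prepends 1 t n π → T t n π
          drop (m , m∈ , π′ , _ , x , π≡) with JustBelow-1 m∈
          ... | refl = subst (T t n) (sym π≡) x

      Prepends-count₂ : ∀ l′ t n → (∀ n′ → HasCount (T t n′) (Hc k J i d t n′)) →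
                        HasCount (Prepends (2 + l′) t n)
                                 (shiftCoeff (l′ * p) (Hc k J i d t) n + shiftCoeff (l′ * p + p) (Hc k J i d t) n)
      Prepends-count₂ l′ t n count =
        HasCount-cong (λ π → mk⇔ (λ { (inj₁ x) → l′ , from JustBelow-2+ (inj₁ refl) , x
                                     ; (inj₂ x) → suc l′ , from JustBelow-2+ (inj₂ refl) , x })
                                  (λ (m , m∈ , x) → [ (λ { refl → inj₁ x }) , (λ { refl → inj₂ x }) ]
                                                       (to JustBelow-2+ m∈)))
          (cong (λ s → shiftCoeff (l′ * p) (Hc k J i d t) n + shiftCoeff s (Hc k J i d t) n) (+-comm p (l′ * p)))
          (HasCount-⊎ (HasCount-Prepend (Hc k J i d t) p l′ n count)
                      (HasCount-Prepend (Hc k J i d t) p (suc l′) n count)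
                      (λ π (π₁ , _ , x₁ , e₁) (π₂ , _ , x₂ , e₂) →
                         1+n≢n (sym (proj₁ (replicate-++-injective (T<p x₁) (T<p x₂) (trans (sym e₁) e₂))))))

      Extension-count′ : ∀ l n K τ (c : ℕ → ℕ) →
        (∀ t → t ≤ K ⇔ t + l ≤ suc k) → (∀ t → t % 2 ≡ τ ⇔ t ≡₂ l + k + 1) →
        (∀ t → 1 ≤ t → t + l ≤ suc k → t ≡₂ l + k + 1 → HasCount (Prepends l t n) (c t)) →
        HasCount (Extension T p l n) (sumFrom1 K (λ t → if ⌊ t % 2 ≟ τ ⌋ then c t else 0))
      Extension-count′ l n K τ c ≤K⇔ τ⇔ count =
        HasCount-cong (λ π → mk⇔ (λ (t , 1≤t , t≤K , t≡τ , x) → t , 1≤t , to (≤K⇔ t) t≤K , to (τ⇔ t) t≡τ , x)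
                                  (λ (t , 1≤t , t+l≤ , t≡₂ , x) → t , 1≤t , from (≤K⇔ t) t+l≤ , from (τ⇔ t) t≡₂ , x))
          refl
          (HasCount-⋃ (λ t π → t % 2 ≡ τ × Prepends l t n π) _ K
            (λ t 1≤t t≤K → HasCount-if (t % 2) τ λ t≡τ → count t 1≤t (to (≤K⇔ t) t≤K) (to (τ⇔ t) t≡τ))
            (λ { t₁ t₂ π (t₁≡τ , (_ , _ , x₁)) (t₂≡τ , (_ , _ , x₂)) →
                 Prepend-determined x₁ x₂ (to (%2≡⇔≡₂ t₁ t₂) (trans t₁≡τ (sym t₂≡τ))) }))

    Extension-count : ∀ l → 1 ≤ l → l ≤ k →
      (∀ t → 1 ≤ t → t + l ≤ suc k → t ≡₂ l + k + 1 → ∀ n → HasCount (T t n) (Hc k J i d t n)) →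
      ∀ n → HasCount (Extension T p l n) (Hc k J i (suc d) l n)
    Extension-count 1 _ _ count n =
      Extension-count′ 1 n k (k % 2) _
        (λ t → mk⇔ (λ t≤k → subst (_≤ suc k) (+-comm 1 t) (s≤s t≤k))
                   (λ t+1≤ → ≤-pred (subst (_≤ suc k) (+-comm t 1) t+1≤)))
        (λ t → ⇔.trans (%2≡⇔≡₂ t k) (≡₂-respʳ k≡₂1+k+1))
        (λ t 1≤t t+1≤ t≡₂ → Prepends-count₁ t n (count t 1≤t t+1≤ t≡₂ n))
    Extension-count (suc (suc l′)) _ l≤k count n =
      Extension-count′ l n (k ∸ l + 1) ((l + k + 1) % 2) _
        (λ t → mk⇔ (λ t≤ → m≤o∸n⇒m+n≤o t l≤1+k (subst (t ≤_) (sym K≡) t≤))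
                   (λ t+l≤ → subst (t ≤_) K≡ (m+n≤o⇒m≤o∸n t t+l≤)))
        (λ t → %2≡⇔≡₂ t (l + k + 1))
        (λ t 1≤t t+l≤ t≡₂ → Prepends-count₂ l′ t n (count t 1≤t t+l≤ t≡₂))
      where
        l = suc (suc l′)
        l≤1+k = ≤-trans l≤k (n≤1+n k)
        K≡ : suc k ∸ l ≡ k ∸ l + 1
        K≡ = trans (cong (_∸ l) (+-comm 1 k)) (+-∸-comm 1 l≤k)

  windowTarget-step : ∀ q {l t} → t ≡₂ l + k + 1 → suc k0 * q + t ≡₂ suc k0 * suc q + l
  windowTarget-step q {l} {t} t≡₂ = begin
    suc k0 * q + t             ≈⟨ ≡₂-+ (≡₂-refl {suc k0 * q}) t≡₂ ⟩
    suc k0 * q + (l + k + 1)   ≡⟨ cong (suc k0 * q +_) (rearrange₁ l k0) ⟩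
    suc k0 * q + (l + suc k0 + 2)  ≈⟨ ≡₂-+ (≡₂-refl {suc k0 * q}) (n+2≡₂n (l + suc k0)) ⟩
    suc k0 * q + (l + suc k0)  ≡⟨ rearrange₂ k0 q l ⟩
    suc k0 * suc q + l         ∎
    where
      open ≈-Reasoning ≡₂-setoid
      rearrange₁ : ∀ l k0 → l + suc (suc k0) + 1 ≡ l + suc k0 + 2
      rearrange₁ = solve-∀
      rearrange₂ : ∀ k0 q l → suc k0 * q + (l + suc k0) ≡ suc k0 * suc q + l
      rearrange₂ = solve-∀

  topWindow-target : ∀ q m l → (suc k0 * q + m + k ≡₂ suc k0 * suc q + l) ⇔ suc m ≡₂ l
  topWindow-target q m l =
    ⇔.trans (≡₂-respˡ (≡⇒≡₂ (rearrange₁ k0 q m)))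
      (⇔.trans (≡₂-respʳ (≡⇒≡₂ (rearrange₂ k0 q l)))
        (mk⇔ (≡₂-cancelˡ (suc k0 * q + suc k0)) (≡₂-+ (≡₂-refl {suc k0 * q + suc k0}))))
    where
      rearrange₁ : ∀ k0 q m → suc k0 * q + m + suc (suc k0) ≡ suc k0 * q + suc k0 + suc m
      rearrange₁ = solve-∀
      rearrange₂ : ∀ k0 q l → suc k0 * suc q + l ≡ suc k0 * q + suc k0 + l
      rearrange₂ = solve-∀

  module Step (q : ℕ) (J<q : J < q) where

    private
      1+q≢J+1 : suc q ≢ J + 1
      1+q≢J+1 e = <⇒≢ J<q (sym (suc-injective (trans e (+-comm J 1))))

    Admissible-< : ∀ {t n π} → Admissible q t n π → All (_< suc q) π
    Admissible-< adm = All.map s≤s (Admissible.parts≤ adm)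

    Admissible-determined : ∀ {t₁ t₂ n π} → Admissible q t₁ n π → Admissible q t₂ n π → t₁ ≡₂ t₂ → t₁ ≡ t₂
    Admissible-determined adm₁ adm₂ = JustBelow-determined (Admissible.mult-top adm₁) (Admissible.mult-top adm₂)

    module _ {zs : List ℕ} (zs<q : All (_< q) zs) where

      open Blocks q zs zs<q

      descend : ∀ {l t n m a} → Admissible (suc q) l n (blocks m a) → JustBelow a t → t ≡₂ l + k + 1 →
                m * suc q ≤ n × Admissible q t (n ∸ m * suc q) (replicate a q ++ zs)
      descend {l} {t} {n} {m} {a} adm a∈ t≡₂ = proj₁ split , record
        { nonincreasing = Nonincreasing-++⁻ʳ (replicate m (suc q)) nonincreasing
        ; sum≡ = proj₂ split
        ; parts≤ = ++⁺ (replicate⁺ a ≤-refl) (All.map <⇒≤ zs<q)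
        ; parts> = ++⁻ʳ (replicate m (suc q)) parts>
        ; spread = Spread-++⁻ʳ (replicate m (suc q)) spread
        ; parityRule = ParityRule-cong (≡₂-sym (windowTarget-step q t≡₂))
                         (ParityRule-++⁻ʳ _ (replicate m (suc q)) parityRule)
        ; mult-top = subst (λ x → JustBelow x t) (sym (mult-replicate-++ a q zs<q)) a∈
        ; mult-bottom = subst (_≤ k ∸ i) (mult-replicate-++-≢ m _ 1+q≢J+1) mult-bottom
        }
        where
          open Admissible adm
          split = sumL-replicate-++ m (suc q) (replicate a q ++ zs) sum≡

      ascend : ∀ {l t n′ m a} → Admissible q t n′ (replicate a q ++ zs) → JustBelow m l → t + l ≤ suc k →
               t ≡₂ l + k + 1 → Admissible (suc q) l (m * suc q + n′) (blocks m a)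
      ascend {l} {t} {n′} {m} {a} adm m∈ t+l≤ t≡₂ = record
        { nonincreasing = Nonincreasing-replicate-++ m (All.map m≤n⇒m≤1+n parts≤) nonincreasing
        ; sum≡ = trans (sumL-++ (replicate m (suc q)) _) (cong₂ _+_ (sumL-replicate m (suc q)) sum≡)
        ; parts≤ = ++⁺ (replicate⁺ m ≤-refl) (All.map m≤n⇒m≤1+n parts≤)
        ; parts> = ++⁺ (replicate⁺ m (m<n⇒m<1+n J<q)) parts>
        ; spread = Spread-blocks m a spread bound
        ; parityRule = ParityRule-blocks _ m a (ParityRule-cong (windowTarget-step q t≡₂) parityRule) bound
                         (λ _ m+a≡ → from (topWindow-target q m l)
                                       (≡⇒≡₂ (trans (+-comm 1 m) (JustBelow-top m∈ a<t t+l≤ m+a≡))))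
        ; mult-top = subst (λ x → JustBelow x l) (sym (mult-replicate-++ m (suc q) (Admissible-< adm))) m∈
        ; mult-bottom = subst (_≤ k ∸ i) (sym (mult-replicate-++-≢ m _ 1+q≢J+1)) mult-bottom
        }
        where
          open Admissible adm
          a<t : a < t
          a<t = subst (_< t) (mult-replicate-++ a q zs<q) (JustBelow⇒< mult-top)
          bound : m + a ≤ suc k0
          bound = <+<-bound (JustBelow⇒< m∈) a<t t+l≤

    step-forward : ∀ {l n π} → Admissible (suc q) l n π → Extension (Admissible q) (suc q) l n π
    step-forward {l} {n} {π} adm with splitTop (suc q) π (Admissible.nonincreasing adm) (Admissible.parts≤ adm)
    ... | m , π′ , refl , π′<p
      with splitTop q π′ (Nonincreasing-++⁻ʳ (replicate m (suc q)) (Admissible.nonincreasing adm)) (All.map ≤-pred π′<p)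
    ... | a , zs , refl , zs<q = extend (choose-t a l k (JustBelow-bound m∈ (Spread-blocks-bound m a spread) not-top))
      where
        open Admissible adm
        open Blocks q zs zs<q
        m∈ : JustBelow m l
        m∈ = subst (λ x → JustBelow x l) (mult-replicate-++ m (suc q) π′<p) mult-top
        not-top : ¬ (m + 2 ≡ l × m + a ≡ suc k0)
        not-top (m+2≡l , m+a≡) =
          suc≢₂ (suc m) (≡₂-sym (≡₂-trans (to (topWindow-target q m l) (topWindow _ m a m+a≡ parityRule))
                                           (≡⇒≡₂ (trans (sym m+2≡l) (+-comm m 2)))))
        extend : (∃ λ t → JustBelow a t × t ≡₂ l + k + 1 × t + l ≤ suc k) →
                 Extension (Admissible q) (suc q) l n (blocks m a)
        extend (t , a∈ , t≡₂ , t+l≤) =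
          t , ≤-trans (s≤s z≤n) (JustBelow⇒< a∈) , t+l≤ , t≡₂ , m , m∈ ,
          _ , proj₁ descended , proj₂ descended , refl
          where descended = descend zs<q {m = m} adm a∈ t≡₂

    step-backward : ∀ {l n π} → Extension (Admissible q) (suc q) l n π → Admissible (suc q) l n π
    step-backward {l} {n} (t , _ , t+l≤ , t≡₂ , m , m∈ , π′ , mp≤n , adm′ , refl)
      with splitTop q π′ (Admissible.nonincreasing adm′) (Admissible.parts≤ adm′)
    ... | a , zs , refl , zs<q =
      subst (λ n′ → Admissible (suc q) l n′ _) (m+[n∸m]≡n mp≤n) (ascend zs<q adm′ m∈ t+l≤ t≡₂)

    step-equivalence : ∀ {l n π} → Admissible (suc q) l n π ⇔ Extension (Admissible q) (suc q) l n π
    step-equivalence = mk⇔ step-forward step-backward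

  -- h^{(J)}_{i,l} = δ_{il} counts the empty partition, attached to the index i
  Initial : ℕ → ℕ → List ℕ → Set
  Initial t n π = t ≡ i × n ≡ 0 × π ≡ []

  Initial-count : ∀ t n → HasCount (Initial t n) (Hc k J i 0 t n)
  Initial-count t n with t ≟ i | n ≟ 0
  ... | yes refl | yes refl = [] ∷ [] , [] ∷ [] ,
          (λ π → mk⇔ (λ { (here refl) → refl , refl , refl }) (λ { (_ , _ , refl) → here refl })) , refl
  ... | yes refl | no n≢0 = HasCount-none (λ π (_ , n≡0 , _) → n≢0 n≡0)
  ... | no t≢i | _ = HasCount-none (λ π (t≡i , _) → t≢i t≡i)

  module Base (1≤i : 1 ≤ i) (i≤k : i ≤ k) where

    private
      no-parts-between : ∀ {xs} → All (_< suc J) xs → All (J <_) xs → xs ≡ []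
      no-parts-between [] [] = refl
      no-parts-between (x≤J ∷ _) (J<x ∷ _) = contradiction (≤-pred x≤J) (<⇒≱ J<x)

      mult-J+1 : ∀ m → mult (J + 1) (replicate m (suc J) ++ []) ≡ m
      mult-J+1 m = trans (cong (λ p → mult p (replicate m (suc J) ++ [])) (+-comm J 1))
                         (mult-replicate-++ m (suc J) [])

    open Blocks J [] []

    base-forward : ∀ {l n π} → i ≡₂ l + k + 1 → Admissible (suc J) l n π → Extension Initial (suc J) l n π
    base-forward {l} {n} {π} i≡₂ adm with splitTop (suc J) π (Admissible.nonincreasing adm) (Admissible.parts≤ adm)
    ... | m , π′ , refl , π′<p with no-parts-between π′<p (++⁻ʳ (replicate m (suc J)) (Admissible.parts> adm))
    ... | refl = i , 1≤i , JustBelow-bound m∈ m+i≤k not-top , i≡₂ , m , m∈ ,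
                 [] , proj₁ split , (refl , sym (proj₂ split) , refl) , refl
      where
        open Admissible adm
        split = sumL-replicate-++ m (suc J) [] sum≡
        m∈ : JustBelow m l
        m∈ = subst (λ x → JustBelow x l) (mult-replicate-++ m (suc J) []) mult-top
        m+i≤k : m + i ≤ k
        m+i≤k = m≤o∸n⇒m+n≤o m i≤k (subst (_≤ k ∸ i) (mult-J+1 m) mult-bottom)
        -- if l = m + 2 and m + i = k then i + l = k + 2, of the wrong parity
        not-top : ¬ (m + 2 ≡ l × m + i ≡ k)
        not-top (m+2≡l , m+i≡k) =
          suc≢₂ (l + k + 1) (≡₂-sym (≡₂-trans (≡₂-sym i≡₂) (≡₂-trans (+≡⇒≡₂ i+l≡) (≡⇒≡₂ (rearrange₂ l k)))))
          where
            rearrange₁ : ∀ i m → i + (m + 2) ≡ m + i + 2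
            rearrange₁ = solve-∀
            rearrange₂ : ∀ l k → l + (k + 2) ≡ suc (l + k + 1)
            rearrange₂ = solve-∀
            i+l≡ : i + l ≡ k + 2
            i+l≡ = trans (cong (i +_) (sym m+2≡l)) (trans (rearrange₁ i m) (cong (_+ 2) m+i≡k))

    base-backward : ∀ {l n π} → Extension Initial (suc J) l n π → Admissible (suc J) l n π
    base-backward {l} {n} (t , _ , i+l≤ , _ , m , m∈ , _ , mp≤n , (refl , n∸mp≡0 , refl) , refl) = record
      { nonincreasing = Nonincreasing-replicate-++ m [] ni-[]
      ; sum≡ = begin
          sumL (replicate m (suc J) ++ [])   ≡⟨ sumL-++ (replicate m (suc J)) [] ⟩
          sumL (replicate m (suc J)) + 0     ≡⟨ +-identityʳ _ ⟩
          sumL (replicate m (suc J))         ≡⟨ sumL-replicate m (suc J) ⟩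
          m * suc J                          ≡⟨ ≤-antisym mp≤n (m∸n≡0⇒m≤n n∸mp≡0) ⟩
          n                                  ∎
      ; parts≤ = ++⁺ (replicate⁺ m ≤-refl) []
      ; parts> = ++⁺ (replicate⁺ m ≤-refl) []
      ; spread = Spread-blocks m 0 Spread-[] bound
      ; parityRule = ParityRule-blocks _ m 0 (ParityRule-[] _) bound
                       (λ _ m+0≡ → from (topWindow-target J m l)
                                     (≡⇒≡₂ (trans (+-comm 1 m) (JustBelow-top m∈ 1≤i i+l≤ m+0≡))))
      ; mult-top = subst (λ x → JustBelow x l) (sym (mult-replicate-++ m (suc J) [])) m∈
      ; mult-bottom = subst (_≤ k ∸ i) (sym (mult-J+1 m)) (m+n≤o⇒m≤o∸n m m+i≤k)
      }
      where
        open ≡-Reasoning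
        bound : m + 0 ≤ suc k0
        bound = <+<-bound (JustBelow⇒< m∈) 1≤i i+l≤
        m+i≤k : m + i ≤ k
        m+i≤k = ≤-pred (≤-trans (+-monoˡ-≤ i (JustBelow⇒< m∈)) (subst (_≤ suc k) (+-comm i l) i+l≤))

    base-equivalence : ∀ {l n π} → i ≡₂ l + k + 1 → Admissible (suc J) l n π ⇔ Extension Initial (suc J) l n π
    base-equivalence i≡₂ = mk⇔ (base-forward i≡₂) base-backward

  Admissible-count : 1 ≤ i → i ≤ k → ∀ d l → 1 ≤ l → l ≤ k → Compatible (suc d) l → ∀ n →
                     HasCount (Admissible (J + suc d) l n) (Hc k J i (suc d) l n)
  Admissible-count 1≤i i≤k zero l 1≤l l≤k compat n =
    HasCount-cong (λ π → ⇔.sym (subst (λ p → Admissible p l n π ⇔ Extension Initial p l n π) (+-comm 1 J)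
                                       (Base.base-equivalence 1≤i i≤k (Compatible-one compat))))
      refl
      (Extension-count 0 Initial (λ { (_ , _ , refl) → [] }) (λ (t₁≡i , _) (t₂≡i , _) _ → trans t₁≡i (sym t₂≡i))
         l 1≤l l≤k (λ t _ _ _ → Initial-count t) n)
  Admissible-count 1≤i i≤k (suc d) l 1≤l l≤k compat n =
    HasCount-cong (λ π → ⇔.sym (subst (λ p → Admissible p l n π ⇔ Extension (Admissible q) p l n π) p≡
                                       step-equivalence))
      refl
      (Extension-count (suc d) (Admissible q) (λ {_} {_} {π} → subst (λ p → All (_< p) π) p≡ ∘ Admissible-<)
         Admissible-determined l 1≤l l≤k
         (λ t 1≤t t+l≤ t≡₂ → Admissible-count 1≤i i≤k d t 1≤t (t≤k t+l≤)
                               (to (Compatible-step {suc d} {l} {t} t≡₂) compat))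
         n)
    where
      q = J + suc d
      p≡ : suc q ≡ J + suc (suc d)
      p≡ = sym (+-suc J (suc d))
      open Step q (m<m+n J z<s)
      t≤k : ∀ {t} → t + l ≤ suc k → t ≤ k
      t≤k {t} t+l≤ = ≤-pred (≤-trans (subst (_≤ t + l) (+-comm t 1) (+-monoʳ-≤ t 1≤l)) t+l≤)

theorem7p1 : (k J : ℕ) → 2 ≤ k → (j : ℕ) → J + 1 ≤ j →
    (i l : ℕ) → 1 ≤ i → i ≤ k → 1 ≤ l → l ≤ k →
    ((k % 2 ≡ 1) → (l % 2 ≢ i % 2) → ∀ n → h k J i j l n ≡ 0)
    × ((k % 2 ≡ 0) → ((j ∸ J + l) % 2 ≢ i % 2) → ∀ n → h k J i j l n ≡ 0)
    × ((k % 2 ≡ 1 → l % 2 ≡ i % 2) →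
       (k % 2 ≡ 0 → (j ∸ J + l) % 2 ≡ i % 2) →
       ∀ n → HasCount (λ π → IsPartition n π × Conditions k J i j l π)
                      (h k J i j l n))
theorem7p1 (suc (suc k0)) J (s≤s (s≤s z≤n)) j J<j i l 1≤i i≤k 1≤l l≤k =
  (λ k-odd l≢i → Hc-vanishes d l (λ c → l≢i (proj₁ (to (Compatible⇔%2 d l) c) k-odd))) ,
  (λ k-even d+l≢i → Hc-vanishes d l (λ c → d+l≢i (proj₂ (to (Compatible⇔%2 d l) c) k-even))) ,
  λ odd-case even-case n →
    HasCount-cong (λ π → ⇔.sym (Admissible⇔ j l n π)) refl
      (subst (λ j′ → HasCount (Admissible j′ l n) (Hc k J i d l n)) (m+[n∸m]≡n J≤j)
        (counting d 1≤d (from (Compatible⇔%2 d l) (odd-case , even-case)) n))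
  where
    k = suc (suc k0)
    open Partitions k0 J i
    d = j ∸ J
    J≤j = ≤-trans (m≤m+n J 1) J<j
    1≤d : 1 ≤ d
    1≤d = m+n≤o⇒m≤o∸n 1 (subst (_≤ j) (+-comm J 1) J<j)
    counting : ∀ d → 1 ≤ d → Compatible d l → ∀ n → HasCount (Admissible (J + d) l n) (Hc k J i d l n)
    counting (suc d) _ = Admissible-count 1≤i i≤k d l 1≤l l≤k
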